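{- Let $n$ be an odd positive integer and $a\in\mathbb{F}_{2^n}$ nonzero with $\operatorname{tr}(1/a)=1$. Let $D$ be the $n\times n$ matrix over $\mathbb{F}_{2^n}$ with rows and columns indexed by $0,1,\ldots,n-1$, whose entries are $D_{i,i}=1+a^{2^i}$, $D_{i,i+1 \bmod n}=1+a^{2^{i+1}}$ (so $D_{n-1,0}=1+a$), and all other entries equal to $1$. Let $\tilde p_0$ be the determinant of the $(n-1)\times(n-1)$ matrix obtained from $D$ by deleting row $0$ and column $0$. Then $$\tilde p_0=\frac{1}{a}\left(1+\frac{1}{a}\langle\{2,4,\ldots,n-1\}\rangle\right).$$
   Context: $\operatorname{tr}(x)=\sum_{i=0}^{n-1}x^{2^i}$ is the absolute trace of $\mathbb{F}_{2^n}$. For $c\in\mathbb{F}_{2^n}$ and $I\subseteq\{0,\ldots,n-1\}$, $c\langle I\rangle=\sum_{i\in I}c^{2^i}$; here $c=1/a$. The matrix $D$ is the Dickson matrix of the linearized polynomial $ax+a^2x^2+\operatorname{tr}(x)$, and $\tilde p_0$ is its $(0,0)$ cofactor (signs are irrelevant in characteristic $2$). -}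

module Defs where

open import Level using (Level; _⊔_)
open import Algebra.Bundles using (CommutativeRing)
open import Data.Nat as ℕ using (ℕ; zero; suc; _≡ᵇ_)
open import Data.Nat.DivMod using (_%_)
open import Data.Bool using (Bool; true; false; if_then_else_; _∧_)
open import Data.Fin using (Fin; zero; suc; toℕ; punchIn)
open import Data.Product using (Σ; _×_)
open import Relation.Nullary using (¬_)
open import Relation.Binary.PropositionalEquality using (_≡_)

module _ {c ℓ : Level} (R : CommutativeRing c ℓ) where
  open CommutativeRing R hiding (zero)

  pow : Carrier → ℕ → Carrier
  pow x zero = 1#
  pow x (suc k) = x * pow x k

  frob : ℕ → Carrier → Carrier
  frob i x = pow x (2 ℕ.^ i)

  sumFin : (n : ℕ) → (Fin n → Carrier) → Carrier
  sumFin zero f = 0#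
  sumFin (suc n) f = f zero + sumFin n (λ i → f (suc i))

  trace : ℕ → Carrier → Carrier
  trace n x = sumFin n (λ i → frob (toℕ i) x)

  -- c⟨I⟩ = Σ_{i ∈ I} c^(2^i), with I ⊆ {0..n-1} given as a Boolean predicate
  angle : (n : ℕ) → (Fin n → Bool) → Carrier → Carrier
  angle n I x = sumFin n (λ i → if I i then frob (toℕ i) x else 0#)

  det : (n : ℕ) → (Fin n → Fin n → Carrier) → Carrier
  det zero M = 1#
  det (suc n) M =
    sumFin (suc n) (λ j → pow (- 1#) (toℕ j) * (M zero j * det n (λ r s → M (suc r) (punchIn j s))))

  D : (n : ℕ) → Carrier → Fin n → Fin n → Carrier
  D n a i j =
    if toℕ j ≡ᵇ toℕ i then 1# + frob (toℕ i) a
    else if toℕ j ≡ᵇ (suc (toℕ i) % suc (ℕ.pred n)) then 1# + frob (toℕ j) a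
    else 1#

  p̃₀ : (m : ℕ) → Carrier → Carrier
  p̃₀ m a = det m (λ r s → D (suc m) a (suc r) (suc s))

  -- the index set {2,4,...} ∩ {0..n-1}  (for odd n this is {2,4,...,n-1})
  evenFromTwo : (n : ℕ) → Fin n → Bool
  evenFromTwo n i = (toℕ i % 2 ≡ᵇ 0) ∧ (2 ℕ.≤ᵇ toℕ i)

  record IsFiniteFieldOfOrder (q : ℕ) : Set (c ⊔ ℓ) where
    field
      one≉zero : ¬ (1# ≈ 0#)
      inverse  : ∀ x → ¬ (x ≈ 0#) → Σ Carrier (λ y → x * y ≈ 1#)
      enum     : Fin q → Carrier
      enum-inj : ∀ i j → enum i ≈ enum j → i ≡ j
      enum-sur : ∀ x → Σ (Fin q) (λ i → enum i ≈ x)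

module Submission where

open import Defs
open import Level using (Level)
open import Algebra.Bundles using (CommutativeRing)
open import Data.Nat using (ℕ; suc; _^_)
open import Data.Nat.DivMod using (_%_)
open import Relation.Binary.PropositionalEquality using (_≡_)

open import Data.Nat as ℕ using (zero; _≡ᵇ_; _<_; s≤s)
open import Data.Nat.DivMod using (n%n≡0; m<n⇒m%n≡m)
open import Data.Nat.Properties using (<-irrefl; ≤∧≢⇒<)
open import Data.Fin as Fin using (Fin; toℕ; punchIn; inject₁) renaming (zero to fz; suc to fs)
open import Data.Fin.Properties using (toℕ<n; toℕ-inject₁; toℕ-fromℕ)
open import Data.Fin.Permutation using (Permutation; permutation)
open import Data.Vec.Functional using (_∷_)
open import Data.Product using (_×_; _,_; proj₁; proj₂; ∃; uncurry)
open import Data.Bool using (Bool; true; false; if_then_else_; _∧_)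
open import Data.Empty using (⊥-elim)
open import Function using (_∘_)
open import Relation.Nullary using (¬_; Dec; yes; no)
import Relation.Binary.PropositionalEquality as P

-- A finite field of order 2^n has characteristic 2 (translation by 1 permutes
-- its elements, so 2^n · 1 = 0).  Hence the signed Laplace expansion `det`
-- agrees with the sign-free one, the permanent `perm`, which is alternating in
-- any two rows; adding a multiple of one row to another therefore preserves it.
-- With bᵢ = a^(2^i) and γᵢ = c^(2^i) (c = 1/a) the minor of D is J + B, J the
-- all-ones matrix and B upper bidiagonal with diagonal b₁, b₂, … and
-- superdiagonal b₂, b₃, ….  Adding every row to the next one leaves a `band`
-- matrix whose permanent obeys a one-step recursion (`band-step`), solved in
-- closed form (`band-closed`) as b₁⋯b_{n-1} times a two-step recurrence in
-- the γᵢ.  For odd n that recurrence produces γ₂ + γ₄ + ⋯ + γ_{n-1}, and the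
-- product is c because a^(2^n) = a, which follows from tr(c) = 1.

≡ᵇ-refl : ∀ t → (t ≡ᵇ t) ≡ true
≡ᵇ-refl zero = P.refl
≡ᵇ-refl (suc t) = ≡ᵇ-refl t

≡ᵇ-suc : ∀ t → (t ≡ᵇ suc t) ≡ false
≡ᵇ-suc zero = P.refl
≡ᵇ-suc (suc t) = ≡ᵇ-suc t

≡ᵇ-false : ∀ {t i} → ¬ (t ≡ i) → (t ≡ᵇ i) ≡ false
≡ᵇ-false {zero} {zero} t≢i = ⊥-elim (t≢i P.refl)
≡ᵇ-false {zero} {suc i} _ = P.refl
≡ᵇ-false {suc t} {zero} _ = P.refl
≡ᵇ-false {suc t} {suc i} t≢i = ≡ᵇ-false (t≢i ∘ P.cong suc)

-- Inside the (0,0) minor the cyclic successor (i+1) mod n of D's column index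
-- never wraps around: comparing with it is comparing with i + 1.
successor-noWrap : ∀ {m t i} → t < m → i < m →
  (suc t ≡ᵇ (suc (suc i) % suc m)) ≡ (t ≡ᵇ suc i)
successor-noWrap {m} {t} {i} t<m i<m with suc i ℕ.≟ m
... | yes P.refl = P.trans (P.cong (suc t ≡ᵇ_) (n%n≡0 (suc (suc i))))
                           (P.sym (≡ᵇ-false (λ t≡m → <-irrefl t≡m t<m)))
... | no i+1≢m = P.cong (suc t ≡ᵇ_) (m<n⇒m%n≡m (s≤s (≤∧≢⇒< i<m i+1≢m)))

-- Expanding along two rows chooses a column j for the first row and the
-- column punchIn j l for the second.  swapPair exchanges the two choices:
-- it returns (j′, l′) with j′ = punchIn j l and punchIn j′ l′ = j, and the
-- remaining columns are the same.
swapPair : ∀ {m} → Fin (suc m) → Fin m → Fin (suc m) × Fin m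
swapPair {suc m} fz l = fs l , fz
swapPair (fs j) fz = fz , j
swapPair (fs j) (fs l) = fs (proj₁ (swapPair j l)) , fs (proj₂ (swapPair j l))

swapPair-first : ∀ {m} (j : Fin (suc m)) l → proj₁ (swapPair j l) ≡ punchIn j l
swapPair-first {suc m} fz l = P.refl
swapPair-first (fs j) fz = P.refl
swapPair-first (fs j) (fs l) = P.cong fs (swapPair-first j l)

swapPair-second : ∀ {m} (j : Fin (suc m)) l → uncurry punchIn (swapPair j l) ≡ j
swapPair-second {suc m} fz l = P.refl
swapPair-second (fs j) fz = P.refl
swapPair-second (fs j) (fs l) = P.cong fs (swapPair-second j l)

swapPair-rest : ∀ {m} (j : Fin (suc (suc m))) l (s : Fin m) →
  punchIn j (punchIn l s) ≡ punchIn (proj₁ (swapPair j l)) (punchIn (proj₂ (swapPair j l)) s)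
swapPair-rest fz l s = P.refl
swapPair-rest (fs j) fz s = P.refl
swapPair-rest {suc m} (fs j) (fs l) fz = P.refl
swapPair-rest {suc m} (fs j) (fs l) (fs s) = P.cong fs (swapPair-rest j l s)

double : ℕ → ℕ
double zero = zero
double (suc h) = suc (suc (double h))

odd⇒double : ∀ m → suc m % 2 ≡ 1 → ∃ λ h → m ≡ double h
odd⇒double zero _ = 0 , P.refl
odd⇒double (suc zero) ()
odd⇒double (suc (suc m)) odd with odd⇒double m odd
... | h , P.refl = suc h , P.refl

module _ {c ℓ : Level} (F : CommutativeRing c ℓ) where
  open CommutativeRing F hiding (zero)
  open import Algebra.Properties.Semiring.Sum semiring
    using (sum; sum-cong-≋; ∑-distrib-+; *-distribˡ-sum; sum-replicate; sum-replicate-zero;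
           sum-init-last; sum-permute)
  open import Algebra.Properties.Semiring.Mult semiring using (×1-homo-*) renaming (_×_ to _times_)
  open import Algebra.Properties.Group +-group using (inverseʳ-unique)
  open import Relation.Binary.Reasoning.Setoid setoid
  open import Algebra.Solver.Ring.NaturalCoefficients.Default commutativeSemiring

  sumFin≡sum : ∀ n (f : Fin n → Carrier) → sumFin F n f ≡ sum f
  sumFin≡sum zero f = P.refl
  sumFin≡sum (suc n) f = P.cong (f fz +_) (sumFin≡sum n (f ∘ fs))

  sum-zero : ∀ {n} {f : Fin n → Carrier} → (∀ i → f i ≈ 0#) → sum f ≈ 0#
  sum-zero {n} f≈0 = trans (sum-cong-≋ f≈0) (sum-replicate-zero n)

  sum-linear : ∀ {n} k (f g : Fin n → Carrier) → sum (λ i → f i + k * g i) ≈ sum f + k * sum g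
  sum-linear k f g = trans (∑-distrib-+ f (λ i → k * g i)) (+-congˡ (sym (*-distribˡ-sum k g)))

  sum-snoc : ∀ n (f : ℕ → Carrier) → sum {suc n} (f ∘ toℕ) ≈ sum {n} (f ∘ toℕ) + f n
  sum-snoc n f = trans (sum-init-last (f ∘ toℕ))
    (+-cong (sum-cong-≋ {n} (λ i → reflexive (P.cong f (toℕ-inject₁ i)))) (reflexive (P.cong f (toℕ-fromℕ n))))

  -- Sums over the pairs (j, l) of swapPair, i.e. over ordered pairs of
  -- distinct columns.
  pairSum : ∀ m → (Fin (suc m) → Fin m → Carrier) → Carrier
  pairSum m G = sum (λ j → sum (G j))

  pairSum-linear : ∀ m k (G H : Fin (suc m) → Fin m → Carrier) →
    pairSum m (λ j l → G j l + k * H j l) ≈ pairSum m G + k * pairSum m H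
  pairSum-linear m k G H = trans (sum-cong-≋ (λ j → sum-linear k (G j) (H j))) (sum-linear k (sum ∘ G) (sum ∘ H))

  -- The pairs (0, l) and (j+1, 0) are exchanged by swapPair; the rest recurse.
  pairSum-split : ∀ m (G : Fin (suc (suc m)) → Fin (suc m) → Carrier) →
    pairSum (suc m) G ≈ sum (G fz) + (sum (λ j → G (fs j) fz) + pairSum m (λ j l → G (fs j) (fs l)))
  pairSum-split m G = +-congˡ (∑-distrib-+ (λ j → G (fs j) fz) (λ j → sum (λ l → G (fs j) (fs l))))

  pairSum-swap : ∀ m (G H : Fin (suc m) → Fin m → Carrier) →
    (∀ j l → G j l ≈ uncurry H (swapPair j l)) → pairSum m G ≈ pairSum m H
  pairSum-swap zero G H _ = refl
  pairSum-swap (suc m) G H G≈H∘swap = begin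
      pairSum (suc m) G
    ≈⟨ pairSum-split m G ⟩
      sum (G fz) + (sum (λ j → G (fs j) fz) + pairSum m (λ j l → G (fs j) (fs l)))
    ≈⟨ +-cong (sum-cong-≋ (G≈H∘swap fz))
              (+-cong (sum-cong-≋ (λ j → G≈H∘swap (fs j) fz))
                      (pairSum-swap m (λ j l → G (fs j) (fs l)) (λ j l → H (fs j) (fs l)) (λ j l → G≈H∘swap (fs j) (fs l)))) ⟩
      B + (A + C)
    ≈⟨ solve 3 (λ b a r → b :+ (a :+ r) := a :+ (b :+ r)) refl B A C ⟩
      A + (B + C)
    ≈⟨ sym (pairSum-split m H) ⟩
      pairSum (suc m) H ∎
    where
      A = sum (H fz)
      B = sum (λ j → H (fs j) fz)
      C = pairSum m (λ j l → H (fs j) (fs l))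

  -- When every element is its own negative, a pair sum invariant under
  -- swapPair vanishes: its terms cancel in pairs.
  pairSum-selfSwap : ∀ m (G : Fin (suc m) → Fin m → Carrier) → (∀ x → x + x ≈ 0#) →
    (∀ j l → G j l ≈ uncurry G (swapPair j l)) → pairSum m G ≈ 0#
  pairSum-selfSwap zero G _ _ = +-identityˡ 0#
  pairSum-selfSwap (suc m) G x+x≈0 G≈G∘swap = begin
      pairSum (suc m) G
    ≈⟨ pairSum-split m G ⟩
      sum (G fz) + (B + pairSum m (λ j l → G (fs j) (fs l)))
    ≈⟨ +-cong (sum-cong-≋ (G≈G∘swap fz))
              (+-congˡ (pairSum-selfSwap m (λ j l → G (fs j) (fs l)) x+x≈0 (λ j l → G≈G∘swap (fs j) (fs l)))) ⟩
      B + (B + 0#)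
    ≈⟨ trans (+-congˡ (+-identityʳ B)) (x+x≈0 B) ⟩
      0# ∎
    where
      B = sum (λ j → G (fs j) fz)

  minor : ∀ {n} → (Fin (suc n) → Fin (suc n) → Carrier) → Fin (suc n) → Fin n → Fin n → Carrier
  minor M j r s = M (fs r) (punchIn j s)

  perm : (n : ℕ) → (Fin n → Fin n → Carrier) → Carrier
  perm zero M = 1#
  perm (suc n) M = sum (λ j → M fz j * perm n (minor M j))

  perm-cong : ∀ n {M N : Fin n → Fin n → Carrier} → (∀ r s → M r s ≈ N r s) → perm n M ≈ perm n N
  perm-cong zero _ = refl
  perm-cong (suc n) M≈N = sum-cong-≋ (λ j → *-cong (M≈N fz j) (perm-cong n (λ r s → M≈N (fs r) (punchIn j s))))

  perm-zeroColumn : ∀ n (M : Fin (suc n) → Fin (suc n) → Carrier) → (∀ r → M r fz ≈ 0#) →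
    perm (suc n) M ≈ 0#
  perm-zeroColumn zero M col = trans (+-identityʳ _) (trans (*-congʳ (col fz)) (zeroˡ _))
  perm-zeroColumn (suc n) M col = sum-zero term
    where
      term : ∀ j → M fz j * perm (suc n) (minor M j) ≈ 0#
      term fz = trans (*-congʳ (col fz)) (zeroˡ _)
      term (fs j) = trans (*-congˡ (perm-zeroColumn n (minor M (fs j)) (col ∘ fs))) (zeroʳ _)

  perm-firstColumn : ∀ n (M : Fin (suc n) → Fin (suc n) → Carrier) → (∀ r → M (fs r) fz ≈ 0#) →
    perm (suc n) M ≈ M fz fz * perm n (minor M fz)
  perm-firstColumn zero M _ = +-identityʳ _
  perm-firstColumn (suc n) M col = trans (+-congˡ (sum-zero later)) (+-identityʳ _)
    where
      later : ∀ j → M fz (fs j) * perm (suc n) (minor M (fs j)) ≈ 0#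
      later j = trans (*-congˡ (perm-zeroColumn n (minor M (fs j)) col)) (zeroʳ _)

  twoRowMinor : ∀ {n} → Fin (suc (suc n)) → Fin (suc n) → (Fin n → Fin (suc (suc n)) → Carrier) → Carrier
  twoRowMinor {n} j l N = perm n (λ r s → N r (punchIn j (punchIn l s)))

  twoRowTerm : ∀ {n} (x y : Fin (suc (suc n)) → Carrier) (N : Fin n → Fin (suc (suc n)) → Carrier) →
    Fin (suc (suc n)) → Fin (suc n) → Carrier
  twoRowTerm x y N j l = x j * (y (punchIn j l) * twoRowMinor j l N)

  perm-twoRows : ∀ {n} x y N → perm (suc (suc n)) (x ∷ y ∷ N) ≈ pairSum (suc n) (twoRowTerm x y N)
  perm-twoRows {n} x y N = sum-cong-≋ (λ j → *-distribˡ-sum (x j) (λ l → y (punchIn j l) * twoRowMinor j l N))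

  twoRowTerm-swap : ∀ {n} x y N (j : Fin (suc (suc n))) l →
    twoRowTerm x y N j l ≈ uncurry (twoRowTerm y x N) (swapPair j l)
  twoRowTerm-swap x y N j l =
    trans (solve 3 (λ a b d → a :* (b :* d) := b :* (a :* d)) refl (x j) (y (punchIn j l)) (twoRowMinor j l N))
      (*-cong (reflexive (P.cong y (P.sym (swapPair-first j l))))
        (*-cong (reflexive (P.cong x (P.sym (swapPair-second j l))))
          (perm-cong _ (λ r s → reflexive (P.cong (N r) (swapPair-rest j l s))))))

  perm-swapRows : ∀ {n} x y N → perm (suc (suc n)) (x ∷ y ∷ N) ≈ perm (suc (suc n)) (y ∷ x ∷ N)
  perm-swapRows x y N = trans (perm-twoRows x y N)
    (trans (pairSum-swap _ (twoRowTerm x y N) (twoRowTerm y x N) (twoRowTerm-swap x y N)) (sym (perm-twoRows y x N)))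

  perm-linear : ∀ {n} (x y z : Fin (suc (suc n)) → Carrier) N k →
    perm (suc (suc n)) (x ∷ (λ s → y s + k * z s) ∷ N)
      ≈ perm (suc (suc n)) (x ∷ y ∷ N) + k * perm (suc (suc n)) (x ∷ z ∷ N)
  perm-linear x y z N k = begin
      perm _ (x ∷ (λ s → y s + k * z s) ∷ N)
    ≈⟨ perm-twoRows x (λ s → y s + k * z s) N ⟩
      pairSum _ (twoRowTerm x (λ s → y s + k * z s) N)
    ≈⟨ sum-cong-≋ (λ j → sum-cong-≋ (λ l →
         solve 5 (λ a b k c d → a :* ((b :+ k :* c) :* d) := a :* (b :* d) :+ k :* (a :* (c :* d)))
           refl (x j) (y (punchIn j l)) k (z (punchIn j l)) (twoRowMinor j l N))) ⟩
      pairSum _ (λ j l → twoRowTerm x y N j l + k * twoRowTerm x z N j l)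
    ≈⟨ pairSum-linear _ k (twoRowTerm x y N) (twoRowTerm x z N) ⟩
      pairSum _ (twoRowTerm x y N) + k * pairSum _ (twoRowTerm x z N)
    ≈⟨ sym (+-cong (perm-twoRows x y N) (*-congˡ (perm-twoRows x z N))) ⟩
      perm _ (x ∷ y ∷ N) + k * perm _ (x ∷ z ∷ N) ∎

  addPreviousRow : ∀ {n k} → (Fin (suc n) → Fin k → Carrier) → Fin (suc n) → Fin k → Carrier
  addPreviousRow M fz = M fz
  addPreviousRow M (fs r) s = M (fs r) s + M (inject₁ r) s

  pow-+ : ∀ x p q → pow F x (p ℕ.+ q) ≈ pow F x p * pow F x q
  pow-+ x zero q = sym (*-identityˡ _)
  pow-+ x (suc p) q = trans (*-congˡ (pow-+ x p q)) (sym (*-assoc _ _ _))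

  pow-distrib-* : ∀ x y k → pow F (x * y) k ≈ pow F x k * pow F y k
  pow-distrib-* x y zero = sym (*-identityˡ 1#)
  pow-distrib-* x y (suc k) = trans (*-congˡ (pow-distrib-* x y k))
    (solve 4 (λ x y p q → (x :* y) :* (p :* q) := (x :* p) :* (y :* q)) refl x y (pow F x k) (pow F y k))

  pow-one : ∀ k → pow F 1# k ≈ 1#
  pow-one zero = refl
  pow-one (suc k) = trans (*-identityˡ _) (pow-one k)

  pow-cong : ∀ k {x y} → x ≈ y → pow F x k ≈ pow F y k
  pow-cong zero _ = refl
  pow-cong (suc k) x≈y = *-cong x≈y (pow-cong k x≈y)

  frob-suc : ∀ i x → frob F (suc i) x ≈ frob F i x * frob F i x
  frob-suc i x = trans (pow-+ x (2 ℕ.^ i) (2 ℕ.^ i ℕ.+ 0)) (*-congˡ (trans (pow-+ x (2 ℕ.^ i) 0) (*-identityʳ _)))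

  frob-inverse : ∀ {a c} → a * c ≈ 1# → ∀ i → frob F i c * frob F i a ≈ 1#
  frob-inverse {a} {c} ac i =
    trans (sym (pow-distrib-* c a (2 ℕ.^ i))) (trans (pow-cong (2 ℕ.^ i) (trans (*-comm c a) ac)) (pow-one (2 ℕ.^ i)))

  frob-fixed-inverse : ∀ {a c} n → a * c ≈ 1# → frob F n c ≈ c → frob F n a ≈ a
  frob-fixed-inverse {a} {c} n ac fixed = begin
      fa                ≈⟨ sym (*-identityʳ fa) ⟩
      fa * 1#           ≈⟨ *-congˡ (sym ac) ⟩
      fa * (a * c)      ≈⟨ solve 3 (λ f a c → f :* (a :* c) := a :* (c :* f)) refl fa a c ⟩
      a * (c * fa)      ≈⟨ *-congˡ (*-congʳ (sym fixed)) ⟩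
      a * (frob F n c * fa) ≈⟨ *-congˡ (frob-inverse ac n) ⟩
      a * 1#            ≈⟨ *-identityʳ a ⟩
      a ∎
    where
      fa = frob F n a

  partialProduct : ℕ → (ℕ → Carrier) → Carrier
  partialProduct zero β = β 1
  partialProduct (suc n) β = β 1 * partialProduct n (β ∘ suc)

  partialProduct-square : ∀ n β → (∀ i → β (suc i) ≈ β i * β i) → partialProduct n β * β 1 ≈ β (suc (suc n))
  partialProduct-square zero β sq = sym (sq 1)
  partialProduct-square (suc n) β sq = begin
      (β 1 * partialProduct n (β ∘ suc)) * β 1
    ≈⟨ solve 2 (λ b p → (b :* p) :* b := p :* (b :* b)) refl (β 1) (partialProduct n (β ∘ suc)) ⟩
      partialProduct n (β ∘ suc) * (β 1 * β 1)
    ≈⟨ *-congˡ (sym (sq 1)) ⟩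
      partialProduct n (β ∘ suc) * β 2
    ≈⟨ partialProduct-square n (β ∘ suc) (sq ∘ suc) ⟩
      β (suc (suc (suc n))) ∎

  partialProduct-frob : ∀ n {a c} → a * c ≈ 1# → frob F (suc (suc n)) a ≈ a →
    partialProduct n (λ i → frob F i a) ≈ c
  partialProduct-frob n {a} {c} ac fixed = begin
      P                              ≈⟨ sym (*-identityʳ P) ⟩
      P * 1#                         ≈⟨ *-congˡ (sym (trans (*-cong ac ac) (*-identityˡ 1#))) ⟩
      P * ((a * c) * (a * c))
    ≈⟨ solve 3 (λ p a c → p :* ((a :* c) :* (a :* c)) := (p :* (a :* (a :* con 1))) :* (c :* c)) refl P a c ⟩
      (P * frob F 1 a) * (c * c)
    ≈⟨ *-congʳ (trans (partialProduct-square n (λ i → frob F i a) (λ i → frob-suc i a)) fixed) ⟩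
      a * (c * c)                    ≈⟨ sym (*-assoc a c c) ⟩
      (a * c) * c                    ≈⟨ trans (*-congʳ ac) (*-identityˡ c) ⟩
      c ∎
    where
      P = partialProduct n (λ i → frob F i a)

  twoStep : ℕ → (ℕ → Carrier) → Carrier → Carrier → Carrier
  twoStep zero γ p q = p
  twoStep (suc n) γ p q = twoStep n (γ ∘ suc) q (γ 3 + p)

  twoStep-cong : ∀ n γ {p p′ q q′} → p ≈ p′ → q ≈ q′ → twoStep n γ p q ≈ twoStep n γ p′ q′
  twoStep-cong zero γ p≈p′ _ = p≈p′
  twoStep-cong (suc n) γ p≈p′ q≈q′ = twoStep-cong n (γ ∘ suc) q≈q′ (+-congˡ p≈p′)

  evenTail : ℕ → (ℕ → Carrier) → Carrier
  evenTail zero γ = 0#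
  evenTail (suc h) γ = γ 4 + evenTail h (γ ∘ suc ∘ suc)

  twoStep-odd : ∀ h γ p q → twoStep (suc (double h)) γ p q ≈ q + evenTail h γ
  twoStep-odd zero γ p q = sym (+-identityʳ q)
  twoStep-odd (suc h) γ p q = begin
      twoStep (suc (double h)) (γ ∘ suc ∘ suc) (γ 3 + p) (γ 4 + q)
    ≈⟨ twoStep-odd h (γ ∘ suc ∘ suc) (γ 3 + p) (γ 4 + q) ⟩
      (γ 4 + q) + E
    ≈⟨ solve 3 (λ g q e → (g :+ q) :+ e := q :+ (g :+ e)) refl (γ 4) q E ⟩
      q + evenTail (suc h) γ ∎
    where
      E = evenTail h (γ ∘ suc ∘ suc)

  -- The summand is evenFromTwo after dropping the indices 0 and 1, where the
  -- test 2 ≤ t + 2 has reduced to true.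
  evenSum : ∀ h (γ : ℕ → Carrier) →
    sumFin F (suc (double h)) (λ i → if (toℕ i % 2 ≡ᵇ 0) ∧ true then γ (suc (suc (toℕ i))) else 0#)
      ≈ γ 2 + evenTail h γ
  evenSum zero γ = refl
  evenSum (suc h) γ = +-congˡ (trans (+-identityˡ _) (evenSum h (γ ∘ suc ∘ suc)))

  angle-odd : ∀ h x → angle F (suc (suc (suc (double h)))) (evenFromTwo F (suc (suc (suc (double h))))) x
                        ≈ frob F 2 x + evenTail h (λ i → frob F i x)
  angle-odd h x = trans (+-identityˡ _) (trans (+-identityˡ _) (evenSum h (λ i → frob F i x)))

  δ : ℕ → ℕ → Carrier → Carrier
  δ t i x = if t ≡ᵇ i then x else 0#

  bandHead : Carrier → Carrier → ℕ → Carrier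
  bandHead x y t = 1# + δ t 0 x + δ t 1 y

  bandRow : (ℕ → Carrier) → ℕ → ℕ → Carrier
  bandRow β i t = δ t i (β (suc i)) + δ t (suc (suc i)) (β (suc (suc (suc i))))

  band : ∀ {n} → (ℕ → Carrier) → Carrier → Carrier → Fin (suc n) → Fin (suc n) → Carrier
  band β x y fz s = bandHead x y (toℕ s)
  band β x y (fs r) s = bandRow β (toℕ r) (toℕ s)

  -- Entries of the (0,0) minor of D, as functions of bᵢ = a^(2^i): the all-ones
  -- matrix plus b_{i+1} on the diagonal and b_{i+2} just right of it.
  minorEntry : (ℕ → Carrier) → ℕ → ℕ → Carrier
  minorEntry b i t = 1# + δ t i (b (suc i)) + δ t (suc i) (b (suc (suc i)))

  minorMatrix : ∀ {n} → (ℕ → Carrier) → Fin n → Fin n → Carrier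
  minorMatrix b r s = minorEntry b (toℕ r) (toℕ s)

  -- Entry (r+1, s+1) of D.  The wrap-around entry D_{n-1,0} lies in the
  -- deleted column, so the minor has no cyclic entries; w is the comparison of
  -- s+1 with the cyclic successor of r+1.
  D-minorEntry : ∀ m a (r s : Fin m) →
    D F (suc m) a (fs r) (fs s) ≈ minorEntry (λ i → frob F i a) (toℕ r) (toℕ s)
  D-minorEntry m a r s = entryCases (toℕ s) (toℕ r) _ (successor-noWrap (toℕ<n s) (toℕ<n r))
    where
      b : ℕ → Carrier
      b i = frob F i a
      entryCases : ∀ t i (w : Bool) → w ≡ (t ≡ᵇ suc i) →
        (if t ≡ᵇ i then 1# + b (suc i) else if w then 1# + b (suc t) else 1#) ≈ minorEntry b i t
      entryCases t i _ P.refl with t ℕ.≟ i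
      ... | yes P.refl rewrite ≡ᵇ-refl t | ≡ᵇ-suc t = sym (+-identityʳ _)
      ... | no t≢i with t ℕ.≟ suc i
      ...   | yes P.refl rewrite ≡ᵇ-false t≢i | ≡ᵇ-refl (suc i) = +-congʳ (sym (+-identityʳ 1#))
      ...   | no t≢i+1 rewrite ≡ᵇ-false t≢i | ≡ᵇ-false t≢i+1 = sym (trans (+-identityʳ _) (+-identityʳ 1#))

  module Characteristic2 (char2 : 1# + 1# ≈ 0#) where

    x+x≈0 : ∀ x → x + x ≈ 0#
    x+x≈0 x = trans (solve 1 (λ x → x :+ x := (con 1 :+ con 1) :* x) refl x) (trans (*-congʳ char2) (zeroˡ x))

    -- Signs are irrelevant, so the determinant is the permanent.
    det≈perm : ∀ n M → det F n M ≈ perm n M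
    det≈perm zero M = refl
    det≈perm (suc n) M =
      trans (reflexive (sumFin≡sum (suc n) (λ j → pow F (- 1#) (toℕ j) * (M fz j * det F n (minor M j)))))
            (sum-cong-≋ (λ j → trans (*-congʳ (sign≈1 (toℕ j)))
                                 (trans (*-identityˡ _) (*-congˡ {M fz j} (det≈perm n (minor M j))))))
      where
        sign≈1 : ∀ k → pow F (- 1#) k ≈ 1#
        sign≈1 k = trans (pow-cong k (sym (inverseʳ-unique 1# 1# char2))) (pow-one k)

    perm-equalRows : ∀ {n} x N → perm (suc (suc n)) (x ∷ x ∷ N) ≈ 0#
    perm-equalRows x N = trans (perm-twoRows x x N) (pairSum-selfSwap _ (twoRowTerm x x N) x+x≈0 (twoRowTerm-swap x x N))

    perm-addRow : ∀ {n} x y N k → perm (suc (suc n)) (x ∷ (λ s → y s + k * x s) ∷ N) ≈ perm (suc (suc n)) (x ∷ y ∷ N)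
    perm-addRow x y N k = begin
        perm _ (x ∷ (λ s → y s + k * x s) ∷ N)
      ≈⟨ perm-linear x y x N k ⟩
        perm _ (x ∷ y ∷ N) + k * perm _ (x ∷ x ∷ N)
      ≈⟨ +-congˡ (trans (*-congˡ (perm-equalRows x N)) (zeroʳ k)) ⟩
        perm _ (x ∷ y ∷ N) + 0#
      ≈⟨ +-identityʳ _ ⟩
        perm _ (x ∷ y ∷ N) ∎

    perm-rowOperation : ∀ {n} x y N k → perm (suc (suc n)) (x ∷ y ∷ N) ≈ perm (suc (suc n)) (y ∷ (λ s → x s + k * y s) ∷ N)
    perm-rowOperation x y N k = trans (perm-swapRows x y N) (sym (perm-addRow y x N k))

    perm-addPreviousRow : ∀ n (M : Fin (suc n) → Fin (suc n) → Carrier) → perm (suc n) (addPreviousRow M) ≈ perm (suc n) M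
    perm-addPreviousRow zero M = refl
    perm-addPreviousRow (suc n) M = begin
        perm _ (addPreviousRow M)
      ≈⟨ perm-cong _ asRows ⟩
        perm _ (M fz ∷ (λ s → M (fs fz) s + 1# * M fz s) ∷ T)
      ≈⟨ perm-addRow (M fz) (M (fs fz)) T 1# ⟩
        perm _ (M fz ∷ M (fs fz) ∷ T)
      ≈⟨ sum-cong-≋ (λ j → *-congˡ {M fz j} (trans (perm-cong _ (minorRows j)) (perm-addPreviousRow n (minor M j)))) ⟩
        perm _ M ∎
      where
        T : Fin n → Fin (suc (suc n)) → Carrier
        T r = addPreviousRow (M ∘ fs) (fs r)
        asRows : ∀ r s → addPreviousRow M r s ≈ (M fz ∷ (λ s → M (fs fz) s + 1# * M fz s) ∷ T) r s
        asRows fz s = refl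
        asRows (fs fz) s = +-congˡ (sym (*-identityˡ _))
        asRows (fs (fs r)) s = refl
        minorRows : ∀ j r s → minor (M fz ∷ M (fs fz) ∷ T) j r s ≈ addPreviousRow (minor M j) r s
        minorRows j fz s = refl
        minorRows j (fs r) s = refl

    -- One elimination step on a band matrix, given γᵢ βᵢ = 1: clearing the
    -- top-left entry with row 1 leaves β₁ times a band matrix one size smaller.
    band-step : ∀ n (β γ : ℕ → Carrier) x y → (∀ i → γ i * β i ≈ 1#) →
      perm (suc (suc n)) (band β x y) ≈ β 1 * perm (suc n) (band (β ∘ suc) y (((1# + x) * γ 1) * β 3))
    band-step n β γ x y inv = begin
        perm (suc (suc n)) (band β x y)
      ≈⟨ perm-cong _ asRows ⟩
        perm (suc (suc n)) (head ∷ row₁ ∷ R)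
      ≈⟨ perm-rowOperation head row₁ R k ⟩
        perm (suc (suc n)) (row₁ ∷ head′ ∷ R)
      ≈⟨ perm-firstColumn (suc n) (row₁ ∷ head′ ∷ R) column₀ ⟩
        (β 1 + 0#) * perm (suc n) (minor (row₁ ∷ head′ ∷ R) fz)
      ≈⟨ *-cong (+-identityʳ (β 1)) (perm-cong _ shifted) ⟩
        β 1 * perm (suc n) (band (β ∘ suc) y (k * β 3)) ∎
      where
        k = (1# + x) * γ 1
        head row₁ head′ : Fin (suc (suc n)) → Carrier
        head s = bandHead x y (toℕ s)
        row₁ s = bandRow β 0 (toℕ s)
        head′ s = head s + k * row₁ s
        R : Fin n → Fin (suc (suc n)) → Carrier
        R r s = bandRow β (suc (toℕ r)) (toℕ s)
        asRows : ∀ r s → band β x y r s ≈ (head ∷ row₁ ∷ R) r s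
        asRows fz s = refl
        asRows (fs fz) s = refl
        asRows (fs (fs r)) s = refl
        -- k was chosen so that the new second row starts with (1+x) + (1+x) = 0.
        head′₀ : head′ fz ≈ 0#
        head′₀ = begin
            ((1# + x) + 0#) + k * (β 1 + 0#)
          ≈⟨ solve 4 (λ x g b o → ((con 1 :+ x) :+ con 0) :+ ((con 1 :+ x) :* g) :* (b :+ con 0)
                                   := (con 1 :+ x) :+ (con 1 :+ x) :* (g :* b)) refl x (γ 1) (β 1) 0# ⟩
            (1# + x) + (1# + x) * (γ 1 * β 1)
          ≈⟨ +-congˡ (trans (*-congˡ (inv 1)) (*-identityʳ _)) ⟩
            (1# + x) + (1# + x)
          ≈⟨ x+x≈0 _ ⟩
            0# ∎
        column₀ : ∀ r → (row₁ ∷ head′ ∷ R) (fs r) fz ≈ 0#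
        column₀ fz = head′₀
        column₀ (fs r) = +-identityʳ 0#
        headShift : ∀ (isOne : Bool) Y → ((1# + 0#) + Y) + k * (0# + (if isOne then β 3 else 0#))
                                           ≈ (1# + Y) + (if isOne then k * β 3 else 0#)
        headShift true Y = solve 3 (λ Y k b → ((con 1 :+ con 0) :+ Y) :+ k :* (con 0 :+ b) := (con 1 :+ Y) :+ k :* b) refl Y k (β 3)
        headShift false Y = solve 2 (λ Y k → ((con 1 :+ con 0) :+ Y) :+ k :* (con 0 :+ con 0) := (con 1 :+ Y) :+ con 0) refl Y k
        shifted : ∀ r s → minor (row₁ ∷ head′ ∷ R) fz r s ≈ band (β ∘ suc) y (k * β 3) r s
        shifted fz s = headShift (toℕ s ≡ᵇ 1) (δ (toℕ s) 0 y)
        shifted (fs r) s = refl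

    band-closed : ∀ n (β γ : ℕ → Carrier) x y → (∀ i → γ i * β i ≈ 1#) →
      perm (suc n) (band β x y) ≈ partialProduct n β * twoStep n γ ((1# + x) * γ 1) ((1# + y) * γ 2)
    band-closed zero β γ x y inv = begin
        ((1# + x) + 0#) * 1# + 0#
      ≈⟨ trans (+-identityʳ _) (trans (*-identityʳ _) (+-identityʳ _)) ⟩
        1# + x
      ≈⟨ sym (trans (*-congˡ (inv 1)) (*-identityʳ _)) ⟩
        (1# + x) * (γ 1 * β 1)
      ≈⟨ solve 3 (λ x g b → (con 1 :+ x) :* (g :* b) := b :* ((con 1 :+ x) :* g)) refl x (γ 1) (β 1) ⟩
        β 1 * ((1# + x) * γ 1) ∎
    band-closed (suc n) β γ x y inv = begin
        perm (suc (suc n)) (band β x y)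
      ≈⟨ band-step n β γ x y inv ⟩
        β 1 * perm (suc n) (band (β ∘ suc) y z)
      ≈⟨ *-congˡ (band-closed n (β ∘ suc) (γ ∘ suc) y z (inv ∘ suc)) ⟩
        β 1 * (partialProduct n (β ∘ suc) * twoStep n (γ ∘ suc) ((1# + y) * γ 2) ((1# + z) * γ 3))
      ≈⟨ *-congˡ (*-congˡ (twoStep-cong n (γ ∘ suc) refl seed)) ⟩
        β 1 * (partialProduct n (β ∘ suc) * twoStep n (γ ∘ suc) ((1# + y) * γ 2) (γ 3 + w))
      ≈⟨ sym (*-assoc _ _ _) ⟩
        partialProduct (suc n) β * twoStep (suc n) γ w ((1# + y) * γ 2) ∎
      where
        w = (1# + x) * γ 1
        z = w * β 3
        seed : (1# + z) * γ 3 ≈ γ 3 + w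
        seed = begin
            (1# + w * β 3) * γ 3
          ≈⟨ solve 3 (λ w b g → (con 1 :+ w :* b) :* g := g :+ w :* (g :* b)) refl w (β 3) (γ 3) ⟩
            γ 3 + w * (γ 3 * β 3)
          ≈⟨ +-congˡ (trans (*-congˡ (inv 3)) (*-identityʳ w)) ⟩
            γ 3 + w ∎

    minorEntry-difference : ∀ b i t → minorEntry b (suc i) t + minorEntry b i t ≈ bandRow b i t
    minorEntry-difference b i t = begin
        ((1# + A) + B) + ((1# + C) + A)
      ≈⟨ solve 3 (λ A B C → ((con 1 :+ A) :+ B) :+ ((con 1 :+ C) :+ A) := (C :+ B) :+ (con 1 :+ con 1) :* (con 1 :+ A)) refl A B C ⟩
        (C + B) + (1# + 1#) * (1# + A)
      ≈⟨ trans (+-congˡ (trans (*-congʳ char2) (zeroˡ _))) (+-identityʳ _) ⟩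
        C + B ∎
      where
        A = δ t (suc i) (b (suc (suc i)))
        B = δ t (suc (suc i)) (b (suc (suc (suc i))))
        C = δ t i (b (suc i))

    minor-band : ∀ n b → perm (suc n) (minorMatrix b) ≈ perm (suc n) (band b (b 1) (b 2))
    minor-band n b = trans (sym (perm-addPreviousRow n (minorMatrix b))) (perm-cong (suc n) rows)
      where
        rows : ∀ r s → addPreviousRow (minorMatrix b) r s ≈ band b (b 1) (b 2) r s
        rows fz s = refl
        rows (fs r) s = trans (+-congˡ (reflexive (P.cong (λ i → minorEntry b i (toℕ s)) (toℕ-inject₁ r))))
                              (minorEntry-difference b (toℕ r) (toℕ s))

    square-+ : ∀ u v → (u + v) * (u + v) ≈ u * u + v * v
    square-+ u v = begin
        (u + v) * (u + v)
      ≈⟨ solve 2 (λ u v → (u :+ v) :* (u :+ v) := (u :* u :+ v :* v) :+ (con 1 :+ con 1) :* (u :* v)) refl u v ⟩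
        (u * u + v * v) + (1# + 1#) * (u * v)
      ≈⟨ trans (+-congˡ (trans (*-congʳ char2) (zeroˡ _))) (+-identityʳ _) ⟩
        u * u + v * v ∎

    sum-square : ∀ {n} (g : Fin n → Carrier) → sum g * sum g ≈ sum (λ i → g i * g i)
    sum-square {zero} g = zeroˡ 0#
    sum-square {suc n} g = trans (square-+ (g fz) _) (+-congˡ (sum-square (g ∘ fs)))

    -- tr(x)² + tr(x) = x + x^(2^n): squaring shifts the trace by one place.
    trace-square : ∀ m x → let S = trace F (suc m) x in S * S + S ≈ x + frob F (suc m) x
    trace-square m x = begin
        S * S + S
      ≈⟨ reflexive (P.cong (λ u → u * u + u) (sumFin≡sum (suc m) f)) ⟩
        sum f * sum f + sum f
      ≈⟨ +-cong square (+-congʳ (*-identityʳ x)) ⟩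
        (T + frob F (suc m) x) + (x + T)
      ≈⟨ solve 3 (λ t f x → (t :+ f) :+ (x :+ t) := (x :+ f) :+ (t :+ t)) refl T (frob F (suc m) x) x ⟩
        (x + frob F (suc m) x) + (T + T)
      ≈⟨ trans (+-congˡ (x+x≈0 T)) (+-identityʳ _) ⟩
        x + frob F (suc m) x ∎
      where
        S = trace F (suc m) x
        f : Fin (suc m) → Carrier
        f i = frob F (toℕ i) x
        T = sum {m} (λ i → frob F (suc (toℕ i)) x)
        square : sum f * sum f ≈ T + frob F (suc m) x
        square = trans (sum-square f) (trans (sum-cong-≋ {suc m} (λ i → sym (frob-suc (toℕ i) x)))
                   (sum-snoc m (λ t → frob F (suc t) x)))

    frob-fixed : ∀ m x → trace F (suc m) x ≈ 1# → frob F (suc m) x ≈ x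
    frob-fixed m x tr = begin
        fx                    ≈⟨ sym (trans (+-congʳ (x+x≈0 x)) (+-identityˡ fx)) ⟩
        (x + x) + fx          ≈⟨ +-assoc x x fx ⟩
        x + (x + fx)          ≈⟨ +-congˡ (sym (trace-square m x)) ⟩
        x + (S * S + S)       ≈⟨ +-congˡ (+-cong (trans (*-cong tr tr) (*-identityˡ 1#)) tr) ⟩
        x + (1# + 1#)         ≈⟨ trans (+-congˡ char2) (+-identityʳ x) ⟩
        x ∎
      where
        fx = frob F (suc m) x
        S = trace F (suc m) x

    cofactor : ∀ h a c → a * c ≈ 1# → trace F (suc (double h)) c ≈ 1# →
      p̃₀ F (double h) a ≈ c * (1# + angle F (suc (double h)) (evenFromTwo F (suc (double h))) c)
    -- For n = 1 the minor is empty and tr(c) = c forces c = 1.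
    cofactor zero a c _ tr = sym (trans (*-cong c≈1 (trans (+-congˡ (+-identityʳ 0#)) (+-identityʳ 1#))) (*-identityˡ 1#))
      where
        c≈1 : c ≈ 1#
        c≈1 = trans (sym (trans (+-identityʳ _) (*-identityʳ c))) tr
    cofactor (suc h) a c ac tr = begin
        p̃₀ F m a
      ≈⟨ det≈perm m (λ r s → D F (suc m) a (fs r) (fs s)) ⟩
        perm m (λ r s → D F (suc m) a (fs r) (fs s))
      ≈⟨ perm-cong m (D-minorEntry m a) ⟩
        perm m (minorMatrix b)
      ≈⟨ minor-band (suc k) b ⟩
        perm m (band b (b 1) (b 2))
      ≈⟨ band-closed (suc k) b γ (b 1) (b 2) (frob-inverse ac) ⟩
        partialProduct (suc k) b * twoStep (suc k) γ ((1# + b 1) * γ 1) ((1# + b 2) * γ 2)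
      ≈⟨ *-cong (partialProduct-frob (suc k) ac (frob-fixed-inverse (suc m) ac (frob-fixed m c tr)))
                (twoStep-odd h γ _ _) ⟩
        c * ((1# + b 2) * γ 2 + evenTail h γ)
      ≈⟨ *-congˡ evens ⟩
        c * (1# + angle F (suc m) (evenFromTwo F (suc m)) c) ∎
      where
        k = double h
        m = suc (suc k)
        b γ : ℕ → Carrier
        b i = frob F i a
        γ i = frob F i c
        evens : (1# + b 2) * γ 2 + evenTail h γ ≈ 1# + angle F (suc m) (evenFromTwo F (suc m)) c
        evens = begin
            (1# + b 2) * γ 2 + evenTail h γ
          ≈⟨ solve 3 (λ b g e → (con 1 :+ b) :* g :+ e := g :* b :+ (g :+ e)) refl (b 2) (γ 2) (evenTail h γ) ⟩
            γ 2 * b 2 + (γ 2 + evenTail h γ)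
          ≈⟨ +-cong (frob-inverse ac 2) (sym (angle-odd h c)) ⟩
            1# + angle F (suc m) (evenFromTwo F (suc m)) c ∎

  module _ {q} (FF : IsFiniteFieldOfOrder F q) where
    open IsFiniteFieldOfOrder FF

    index : Carrier → Fin q
    index x = proj₁ (enum-sur x)

    enum-index : ∀ x → enum (index x) ≈ x
    enum-index x = proj₂ (enum-sur x)

    _≈?_ : ∀ x y → Dec (x ≈ y)
    x ≈? y with index x Fin.≟ index y
    ... | yes same = yes (trans (sym (enum-index x)) (trans (reflexive (P.cong enum same)) (enum-index y)))
    ... | no differ = no (λ x≈y → differ (enum-inj _ _ (trans (enum-index x) (trans x≈y (sym (enum-index y))))))

    translate : Permutation q q
    translate = permutation (λ i → index (enum i + 1#)) (λ i → index (enum i + - 1#))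
      (λ i → enum-inj _ _ (shift (enum-index _) (-‿inverseˡ 1#)))
      (λ i → enum-inj _ _ (shift (enum-index _) (-‿inverseʳ 1#)))
      where
        shift : ∀ {x y u v} → x ≈ y + u → u + v ≈ 0# → enum (index (x + v)) ≈ y
        shift {x} {y} {u} {v} x≈y+u u+v≈0 = begin
            enum (index (x + v)) ≈⟨ enum-index _ ⟩
            x + v                ≈⟨ +-congʳ x≈y+u ⟩
            (y + u) + v          ≈⟨ +-assoc y u v ⟩
            y + (u + v)          ≈⟨ trans (+-congˡ u+v≈0) (+-identityʳ y) ⟩
            y ∎

    -- Σₓ x = Σₓ (x + 1) = Σₓ x + q·1, hence q·1 = 0.
    sum-ones≈0 : sum {q} (λ _ → 1#) ≈ 0#
    sum-ones≈0 = begin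
        ones                    ≈⟨ sym (+-identityˡ ones) ⟩
        0# + ones               ≈⟨ +-congʳ (sym (-‿inverseˡ S)) ⟩
        (- S + S) + ones        ≈⟨ +-assoc _ _ _ ⟩
        - S + (S + ones)        ≈⟨ +-congˡ (sym translated) ⟩
        - S + S                 ≈⟨ -‿inverseˡ S ⟩
        0# ∎
      where
        S = sum enum
        ones = sum {q} (λ _ → 1#)
        translated : S ≈ S + ones
        translated = trans (sum-permute enum translate)
          (trans (sum-cong-≋ {q} (λ i → enum-index _)) (∑-distrib-+ enum (λ _ → 1#)))

  powerOfTwo-times-one : ∀ j → (2 ℕ.^ j) times 1# ≈ pow F (1# + 1#) j
  powerOfTwo-times-one zero = +-identityʳ 1#
  powerOfTwo-times-one (suc j) = trans (×1-homo-* 2 (2 ℕ.^ j)) (*-cong (+-congˡ (+-identityʳ 1#)) (powerOfTwo-times-one j))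

  -- A field of order 2^(k+1) has characteristic 2: otherwise 1 + 1 would be
  -- invertible, but its power (1 + 1)^(k+1) = 2^(k+1) · 1 vanishes.
  characteristic2 : ∀ {k} → IsFiniteFieldOfOrder F (2 ℕ.^ suc k) → 1# + 1# ≈ 0#
  characteristic2 {k} FF with _≈?_ FF (1# + 1#) 0#
  ... | yes two≈0 = two≈0
  ... | no two≉0 = ⊥-elim (IsFiniteFieldOfOrder.one≉zero FF (begin
        1#                                    ≈⟨ sym (pow-one (suc k)) ⟩
        pow F 1# (suc k)                      ≈⟨ pow-cong (suc k) (sym two*y≈1) ⟩
        pow F ((1# + 1#) * y) (suc k)         ≈⟨ pow-distrib-* (1# + 1#) y (suc k) ⟩
        pow F (1# + 1#) (suc k) * pow F y (suc k)
      ≈⟨ *-congʳ (trans (sym (powerOfTwo-times-one (suc k))) (trans (sym (sum-replicate (2 ℕ.^ suc k))) (sum-ones≈0 FF))) ⟩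
        0# * pow F y (suc k)                  ≈⟨ zeroˡ _ ⟩
        0# ∎))
    where
      y = proj₁ (IsFiniteFieldOfOrder.inverse FF (1# + 1#) two≉0)
      two*y≈1 = proj₂ (IsFiniteFieldOfOrder.inverse FF (1# + 1#) two≉0)

lemma2 : {c ℓ : Level} (F : CommutativeRing c ℓ) (m : ℕ)
    → IsFiniteFieldOfOrder F (2 ^ suc m)
    → suc m % 2 ≡ 1
    → (a a⁻¹ : CommutativeRing.Carrier F)
    → CommutativeRing._≈_ F (CommutativeRing._*_ F a a⁻¹) (CommutativeRing.1# F)
    → CommutativeRing._≈_ F (trace F (suc m) a⁻¹) (CommutativeRing.1# F)
    → CommutativeRing._≈_ F (p̃₀ F m a)
        (CommutativeRing._*_ F a⁻¹
          (CommutativeRing._+_ F (CommutativeRing.1# F) (angle F (suc m) (evenFromTwo F (suc m)) a⁻¹)))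
-- n = m + 1 is odd, so m = 2h, and the field has characteristic 2.
lemma2 F m FF odd a a⁻¹ aa⁻¹≈1 tr≈1 with odd⇒double m odd
... | h , P.refl = Characteristic2.cofactor F (characteristic2 F {double h} FF) h a a⁻¹ aa⁻¹≈1 tr≈1
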